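{- Consider the game $\mathbf{0.33}$. Let $S$ be a subdivided star all of whose paths have $1$ or $2$ vertices, with $i\ge 0$ paths in total, of which $j$ ($0\le j\le i$) have $2$ vertices. Then $\mathcal{G}(S)$ is as follows (listing values for $j=0,1,\ldots,i$): \begin{itemize} \item $i=0$: $1$; \item $i=1$: $2, 0$; \item $i=2$: $0,1,2$; \item $i=3$: $1,2,0,1$; \item $i\ge 4$ even: $\mathcal{G}(S)=0,3,1,2$ for $j=0,1,2,3$ respectively, and for $j\ge 4$, $\mathcal{G}(S)=0$ if $j$ is even and $\mathcal{G}(S)=3$ if $j$ is odd; \item $i\ge 5$ odd: $\mathcal{G}(S)=1,2,0,3$ for $j=0,1,2,3$ respectively, and for $j\ge 4$, $\mathcal{G}(S)=1$ if $j$ is even and $\mathcal{G}(S)=2$ if $j$ is odd. \end{itemize} (Also, the empty graph has Grundy value $0$.)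
   Context: The game $\mathbf{0.33}$ on a finite graph $G$: players alternate; a move chooses a set $X$ of one vertex or of two adjacent vertices of $G$, lying in a connected component $H$ of $G$, such that $H-X$ is empty or connected, and deletes $X$. A player unable to move loses (normal play). Grundy value: $\mathcal{G}(G)=\mathrm{mex}\{\mathcal{G}(G'): G' \text{ reachable in one move}\}$, with $\mathrm{mex}(A)$ the least nonnegative integer not in $A$. Subdivided star $S_{\ell_1,\ldots,\ell_k}$ ($k\ge0$, $\ell_i\ge1$): a central vertex $c$ together with $k$ vertex-disjoint paths having $\ell_1,\ldots,\ell_k$ vertices, each with one endpoint adjacent to $c$; for $k=0$ it is a single vertex. -}

module Defs where

open import Level using (0ℓ)
open import Data.Nat using (ℕ; zero; suc; _<_; _≡ᵇ_)
open import Data.Fin using (Fin; toℕ) renaming (zero to fzero; suc to fsuc)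
open import Data.Bool using (Bool; true; false; if_then_else_)
open import Data.Unit using (⊤; tt)
open import Data.Empty using (⊥)
open import Data.Sum using (_⊎_; inj₁; inj₂)
open import Data.Product using (Σ; ∃; _×_; _,_; proj₁)
open import Relation.Binary.PropositionalEquality using (_≡_; _≢_)
open import Relation.Nullary using (¬_)

record Graph : Set₁ where
  field
    V : Set
    E : V → V → Set
open Graph public

-- A vertex set (game position) is a predicate on the vertices; the
-- position is the subgraph of G induced by it.
VSet : Graph → Set₁
VSet G = V G → Set

module _ (G : Graph) where

  data Reach (S : VSet G) : V G → V G → Set where
    here : ∀ {u} → S u → Reach S u u
    step : ∀ {u w v} → S u → E G u w → Reach S w v → Reach S u v

  ConnectedOrEmpty : VSet G → Set
  ConnectedOrEmpty S = ∀ u v → S u → S v → Reach S u v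

  Component : VSet G → V G → VSet G
  Component S u w = Reach S u w

  _∖_ : VSet G → VSet G → VSet G
  (S ∖ X) w = S w × ¬ X w

  -- Legal moves of 0.33 from position S: delete one vertex u, or two
  -- adjacent vertices u,v, such that (component of u) − X is empty or
  -- connected.  (v adjacent to u lies in the same component as u.)
  data Move (S : VSet G) : Set where
    one : (u : V G) → S u →
          ConnectedOrEmpty (Component S u ∖ (λ w → w ≡ u)) → Move S
    two : (u v : V G) → S u → S v → E G u v →
          ConnectedOrEmpty (Component S u ∖ (λ w → w ≡ u ⊎ w ≡ v)) → Move S

  removed : {S : VSet G} → Move S → VSet G
  removed (one u _ _) w = w ≡ u
  removed (two u v _ _ _ _) w = w ≡ u ⊎ w ≡ v

  after : (S : VSet G) → Move S → VSet G
  after S m = S ∖ removed m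

  -- This relation is functional, so it is exactly "𝒢(S) = g".
  data HasGrundy (S : VSet G) (g : ℕ) : Set₁ where
    grundy : (val : (m : Move S) → Σ ℕ (λ h → HasGrundy (after S m) h)) →
             (∀ m → proj₁ (val m) ≢ g) →
             (∀ h → h < g → ∃ λ m → proj₁ (val m) ≡ h) →
             HasGrundy S g

𝒢_≡_ : Graph → ℕ → Set₁
𝒢 G ≡ g = HasGrundy G (λ _ → ⊤) g

emptyGraph : Graph
emptyGraph = record { V = ⊥ ; E = λ _ _ → ⊥ }

-- Subdivided star S_{ℓ_1,…,ℓ_k}: centre, and for each path p a vertex
-- (p , t) with t : Fin (ℓ p); (p , 0) is the endpoint adjacent to the
-- centre and (p , t) ~ (p , t+1).

StarV : (k : ℕ) → (Fin k → ℕ) → Set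
StarV k ℓ = ⊤ ⊎ Σ (Fin k) (λ p → Fin (ℓ p))

data StarE (k : ℕ) (ℓ : Fin k → ℕ) : StarV k ℓ → StarV k ℓ → Set where
  c-p : ∀ p (t : Fin (ℓ p)) → toℕ t ≡ 0 → StarE k ℓ (inj₁ tt) (inj₂ (p , t))
  p-c : ∀ p (t : Fin (ℓ p)) → toℕ t ≡ 0 → StarE k ℓ (inj₂ (p , t)) (inj₁ tt)
  p-p : ∀ p (t t' : Fin (ℓ p)) → suc (toℕ t) ≡ toℕ t' →
        StarE k ℓ (inj₂ (p , t)) (inj₂ (p , t'))
  p-p' : ∀ p (t t' : Fin (ℓ p)) → suc (toℕ t) ≡ toℕ t' →
         StarE k ℓ (inj₂ (p , t')) (inj₂ (p , t))

star : (k : ℕ) → (Fin k → ℕ) → Graph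
star k ℓ = record { V = StarV k ℓ ; E = StarE k ℓ }

countTwos : (k : ℕ) → (Fin k → ℕ) → ℕ
countTwos zero ℓ = 0
countTwos (suc k) ℓ =
  (if ℓ fzero ≡ᵇ 2 then 1 else 0) + countTwos k (λ p → ℓ (fsuc p))
  where open Data.Nat using (_+_)

isEven : ℕ → Bool
isEven zero = true
isEven (suc zero) = false
isEven (suc (suc n)) = isEven n

evenRow : ℕ → ℕ
evenRow 0 = 0
evenRow 1 = 3
evenRow 2 = 1
evenRow 3 = 2
evenRow j@(suc (suc (suc (suc _)))) = if isEven j then 0 else 3

oddRow : ℕ → ℕ
oddRow 0 = 1
oddRow 1 = 2
oddRow 2 = 0
oddRow 3 = 3
oddRow j@(suc (suc (suc (suc _)))) = if isEven j then 1 else 2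

table : ℕ → ℕ → ℕ
table 0 _ = 1
table 1 0 = 2
table 1 _ = 0
table 2 0 = 0
table 2 1 = 1
table 2 _ = 2
table 3 0 = 1
table 3 1 = 2
table 3 2 = 0
table 3 _ = 1
table i@(suc (suc (suc (suc _)))) j = if isEven i then evenRow j else oddRow j

module Submission where

-- As long as the centre survives, every position reached from a subdivided star whose legs have at most two
-- vertices is again such a star, with some legs cut back from their tips.  Its value depends only on the number
-- i of nonempty legs and the number j of two-vertex legs, and table i j satisfies the mex recursion over the
-- three leg moves: delete a one-vertex leg, cut the tip of a two-vertex leg, delete a two-vertex leg.  A move
-- deleting the centre (alone or with the base of a leg) is legal only if the rest stays connected, so at most
-- one leg remains: an empty graph, a vertex or an edge, of values 0, 1, 2, which never equal the table entry.

open import Defs hiding (_∖_)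
open import Data.Bool using (Bool; true; false; not; if_then_else_)
open import Data.Empty using (⊥; ⊥-elim)
open import Data.Fin using (Fin; toℕ; fromℕ<; _≟_) renaming (zero to fzero; suc to fsuc)
open import Data.Fin.Properties using (toℕ-injective; toℕ-fromℕ<; toℕ<n)
open import Data.Nat using (ℕ; zero; suc; _+_; _*_; _≤_; _<_; z≤n; s≤s; _≤?_; _<?_; _≡ᵇ_)
open import Data.Nat.Induction using (<-wellFounded)
open import Data.Nat.Properties
  using ( <-cmp; ≤-refl; ≤-reflexive; ≤-antisym; ≤-trans; <-≤-trans; ≤-pred; <⇒≤; <⇒≱; ≰⇒>; ≮⇒≥
        ; n≮0; n≤0⇒n≡0; n<1⇒n≡0; n≤1⇒n≡0∨n≡1; m≤n⇒m≤1+n; m≤m+n; m≤n⇒∃[o]m+o≡n; suc-injective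
        ; +-identityʳ; +-mono-≤; +-monoˡ-≤; +-monoˡ-<; +-cancelˡ-<; m+n≡0⇒m≡0; m+n≡0⇒n≡0
        ; *-zeroʳ; *-identityʳ; +-commutativeSemigroup )
open import Algebra.Properties.CommutativeSemigroup +-commutativeSemigroup using (x∙yz≈y∙xz)
open import Data.Product using (Σ; ∃; _×_; _,_; proj₁; proj₂)
open import Data.Sum using (_⊎_; inj₁; inj₂; [_,_]; map₁; swap)
open import Data.Unit using (⊤; tt)
open import Data.Vec.Functional using (updateAt)
open import Data.Vec.Functional.Properties using (updateAt-updates; updateAt-minimal; map-updateAt-local)
open import Function using (_∘_; _$_; id; const)
open import Induction.WellFounded using (module All)
open import Relation.Binary using (tri<; tri≈; tri>)
open import Relation.Binary.Construct.On as On using ()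
open import Relation.Binary.PropositionalEquality
  using (_≡_; _≢_; _≗_; refl; sym; trans; cong; cong₂; subst; subst₂; module ≡-Reasoning)
open import Relation.Nullary using (¬_; Dec; yes; no; contradiction)
open import Relation.Unary using (Empty; _⊆_; _≐_; _∖_)
open import Relation.Unary.Properties using (≐-refl; ≐-sym; ≐-trans)

module Positions (G : Graph) where

  ⁅_⁆ : V G → VSet G
  ⁅ a ⁆ w = w ≡ a

  ⁅_∣_⁆ : V G → V G → VSet G
  ⁅ a ∣ b ⁆ w = w ≡ a ⊎ w ≡ b

  ⁅∣⁆-comm : ∀ {a b} → ⁅ a ∣ b ⁆ ≐ ⁅ b ∣ a ⁆
  ⁅∣⁆-comm = swap , swap

  ∖-cong : ∀ {S S′ X X′ : VSet G} → S ≐ S′ → X ≐ X′ → S ∖ X ≐ S′ ∖ X′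
  ∖-cong (S⊆S′ , S′⊆S) (X⊆X′ , X′⊆X) =
    (λ (s , ¬x) → S⊆S′ s , ¬x ∘ X′⊆X) , (λ (s , ¬x) → S′⊆S s , ¬x ∘ X⊆X′)

  ∖-≐ : ∀ {S X Y : VSet G} → (∀ {w} → S w → X w ⊎ Y w) → Y ⊆ S → (∀ {w} → Y w → ¬ X w) →
        S ∖ X ≐ Y
  ∖-≐ {S} {X} {Y} cover Y⊆S Y∩X=∅ = to , λ y → Y⊆S y , Y∩X=∅ y
    where
    to : S ∖ X ⊆ Y
    to (s , ¬x) with cover s
    ... | inj₁ x = ⊥-elim (¬x x)
    ... | inj₂ y = y

  ∖-⁅∣⁆ : ∀ {S : VSet G} {a b} → S ∖ ⁅ a ∣ b ⁆ ≐ (S ∖ ⁅ b ⁆) ∖ ⁅ a ⁆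
  ∖-⁅∣⁆ = (λ (s , ¬ab) → (s , ¬ab ∘ inj₂) , ¬ab ∘ inj₁) , λ ((s , ¬b) , ¬a) → s , [ ¬a , ¬b ]

  ∖-empty : ∀ {S X : VSet G} → S ⊆ X → Empty (S ∖ X)
  ∖-empty S⊆X w (s , ¬x) = ¬x (S⊆X s)

  Reach-mono : ∀ {S T u v} → S ⊆ T → Reach G S u v → Reach G T u v
  Reach-mono S⊆T (here s) = here (S⊆T s)
  Reach-mono S⊆T (step s e r) = step (S⊆T s) e (Reach-mono S⊆T r)

  Reach-source : ∀ {S u v} → Reach G S u v → S u
  Reach-source (here s) = s
  Reach-source (step s _ _) = s

  Reach-target : ∀ {S u v} → Reach G S u v → S v
  Reach-target (here s) = s
  Reach-target (step _ _ r) = Reach-target r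

  Reach-trans : ∀ {S u v w} → Reach G S u v → Reach G S v w → Reach G S u w
  Reach-trans (here _) r = r
  Reach-trans (step s e r) r′ = step s e (Reach-trans r r′)

  Reach-snoc : ∀ {S u v w} → Reach G S u v → E G v w → S w → Reach G S u w
  Reach-snoc (here s) e sw = step s e (here sw)
  Reach-snoc (step s e r) e′ sw = step s e (Reach-snoc r e′ sw)

  Reach-sym : (∀ {x y} → E G x y → E G y x) → ∀ {S u v} → Reach G S u v → Reach G S v u
  Reach-sym E-sym (here s) = here s
  Reach-sym E-sym (step s e r) = Reach-snoc (Reach-sym E-sym r) (E-sym e) s

  Reach-invariant : ∀ {S u v} (P : VSet G) →
                    (∀ {x y} → S x → S y → E G x y → P x → P y) → Reach G S u v → P u → P v
  Reach-invariant P step-P (here _) pu = pu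
  Reach-invariant P step-P (step s e r) pu = Reach-invariant P step-P r (step-P s (Reach-source r) e pu)

  ConnectedOrEmpty-resp-≐ : ∀ {S T} → S ≐ T → ConnectedOrEmpty G S → ConnectedOrEmpty G T
  ConnectedOrEmpty-resp-≐ (S⊆T , T⊆S) conn u v tu tv = Reach-mono S⊆T (conn u v (T⊆S tu) (T⊆S tv))

  ConnectedOrEmpty-empty : ∀ {S} → Empty S → ConnectedOrEmpty G S
  ConnectedOrEmpty-empty empty u _ su _ = ⊥-elim (empty u su)

  ConnectedOrEmpty-⊆⁅⁆ : ∀ {S a} → S ⊆ ⁅ a ⁆ → ConnectedOrEmpty G S
  ConnectedOrEmpty-⊆⁅⁆ S⊆a u v su sv with S⊆a su | S⊆a sv
  ... | refl | refl = here su

  Component-∖ : ∀ {S u} X → ConnectedOrEmpty G S → S u → Component G S u ∖ X ≐ S ∖ X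
  Component-∖ X conn su = ∖-cong (Reach-target , conn _ _ su) ≐-refl

  moved : ∀ {S} → Move G S → V G
  moved (one u _ _) = u
  moved (two u _ _ _ _ _) = u

  moved-∈ : ∀ {S} (m : Move G S) → S (moved m)
  moved-∈ (one _ su _) = su
  moved-∈ (two _ _ su _ _ _) = su

  moved-removed : ∀ {S} (m : Move G S) → removed G m (moved m)
  moved-removed (one _ _ _) = refl
  moved-removed (two _ _ _ _ _ _) = inj₁ refl

  HasGrundy-unique : ∀ {S g g′} → HasGrundy G S g → HasGrundy G S g′ → g ≡ g′
  HasGrundy-¬< : ∀ {S g g′} → HasGrundy G S g → HasGrundy G S g′ → g < g′ → ⊥

  HasGrundy-unique {g = g} {g′} γ γ′ with <-cmp g g′
  ... | tri≈ _ g≡g′ _ = g≡g′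
  ... | tri< g<g′ _ _ = ⊥-elim (HasGrundy-¬< γ γ′ g<g′)
  ... | tri> _ _ g′<g = ⊥-elim (HasGrundy-¬< γ′ γ g′<g)

  HasGrundy-¬< (grundy val avoid _) (grundy val′ _ reach′) g<g′ with reach′ _ g<g′
  ... | m , val′m≡g = avoid m (trans (HasGrundy-unique (proj₂ (val m)) (proj₂ (val′ m))) val′m≡g)

  HasGrundy-intro : ∀ {S g} →
                    ((m : Move G S) → ∃ λ h → HasGrundy G (after G S m) h × h ≢ g) →
                    (∀ h → h < g → ∃ λ m → HasGrundy G (after G S m) h) →
                    HasGrundy G S g
  HasGrundy-intro option mex =
    grundy (λ m → proj₁ (option m) , proj₁ (proj₂ (option m)))
           (λ m → proj₂ (proj₂ (option m)))
           (λ h h<g → let m , γ = mex h h<g in m , HasGrundy-unique (proj₁ (proj₂ (option m))) γ)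

  HasGrundy-empty : ∀ {S} → Empty S → HasGrundy G S 0
  HasGrundy-empty empty = grundy (λ m → ⊥-elim (empty _ (moved-∈ m)))
                                 (λ m → ⊥-elim (empty _ (moved-∈ m)))
                                 (λ _ ())

  Component-resp-≐ : ∀ {S T u} → S ≐ T → Component G S u ≐ Component G T u
  Component-resp-≐ (S⊆T , T⊆S) = Reach-mono S⊆T , Reach-mono T⊆S

  Move-resp-≐ : ∀ {S T} → S ≐ T → Move G S → Move G T
  Move-resp-≐ S≐T (one u su legal) =
    one u (proj₁ S≐T su) (ConnectedOrEmpty-resp-≐ (∖-cong (Component-resp-≐ S≐T) ≐-refl) legal)
  Move-resp-≐ S≐T (two u v su sv e legal) =
    two u v (proj₁ S≐T su) (proj₁ S≐T sv) e
        (ConnectedOrEmpty-resp-≐ (∖-cong (Component-resp-≐ S≐T) ≐-refl) legal)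

  after-resp-≐ : ∀ {S T} (S≐T : S ≐ T) (m : Move G S) → after G S m ≐ after G T (Move-resp-≐ S≐T m)
  after-resp-≐ S≐T (one _ _ _) = ∖-cong S≐T ≐-refl
  after-resp-≐ S≐T (two _ _ _ _ _ _) = ∖-cong S≐T ≐-refl

  after-resp-≐-involutive : ∀ {S T} (S≐T : S ≐ T) (m : Move G S) →
                             after G S (Move-resp-≐ (≐-sym S≐T) (Move-resp-≐ S≐T m)) ≐ after G S m
  after-resp-≐-involutive S≐T (one _ _ _) = ≐-refl
  after-resp-≐-involutive S≐T (two _ _ _ _ _ _) = ≐-refl

  HasGrundy-resp-≐ : ∀ {S T g} → S ≐ T → HasGrundy G S g → HasGrundy G T g
  HasGrundy-resp-≐ {S} {T} S≐T (grundy val avoid reach) = grundy val′ (avoid ∘ back) reach′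
    where
    back : Move G T → Move G S
    back = Move-resp-≐ (≐-sym S≐T)
    val′ : (m : Move G T) → Σ ℕ λ h → HasGrundy G (after G T m) h
    val′ m = proj₁ (val (back m)) ,
             HasGrundy-resp-≐ (≐-sym (after-resp-≐ (≐-sym S≐T) m)) (proj₂ (val (back m)))
    reach′ : ∀ h → h < _ → ∃ λ m → proj₁ (val′ m) ≡ h
    reach′ h h<g with m , val-m≡h ← reach h h<g =
      Move-resp-≐ S≐T m ,
      trans (HasGrundy-unique
               (HasGrundy-resp-≐ (after-resp-≐-involutive S≐T m) (proj₂ (val (back (Move-resp-≐ S≐T m)))))
               (proj₂ (val m)))
            val-m≡h

  HasGrundy-⁅⁆ : ∀ {a} → HasGrundy G ⁅ a ⁆ 1
  HasGrundy-⁅⁆ {a} = HasGrundy-intro option mex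
    where
    all-removed : (m : Move G ⁅ a ⁆) → Empty (after G ⁅ a ⁆ m)
    all-removed m = ∖-empty λ { refl → subst (removed G m) (moved-∈ m) (moved-removed m) }
    option : (m : Move G ⁅ a ⁆) → ∃ λ h → HasGrundy G (after G ⁅ a ⁆ m) h × h ≢ 1
    option m = 0 , HasGrundy-empty (all-removed m) , λ ()
    take-a : Move G ⁅ a ⁆
    take-a = one a refl (ConnectedOrEmpty-empty (∖-empty Reach-target))
    mex : ∀ h → h < 1 → ∃ λ m → HasGrundy G (after G ⁅ a ⁆ m) h
    mex zero _ = take-a , HasGrundy-empty (all-removed take-a)
    mex (suc _) (s≤s ())

  HasGrundy-⁅∣⁆ : ∀ {a b} → a ≢ b → E G a b → HasGrundy G ⁅ a ∣ b ⁆ 2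
  HasGrundy-⁅∣⁆ {a} {b} a≢b eab = HasGrundy-intro option mex
    where
    leaves : ∀ {x y} {X : VSet G} → ⁅ a ∣ b ⁆ ≐ ⁅ x ∣ y ⁆ → X x → ¬ X y → HasGrundy G (⁅ a ∣ b ⁆ ∖ X) 1
    leaves {x} {y} {X} (ab⊆xy , xy⊆ab) Xx ¬Xy =
      HasGrundy-resp-≐ (≐-sym (∖-≐ cover (λ { refl → xy⊆ab (inj₂ refl) }) λ { refl → ¬Xy })) HasGrundy-⁅⁆
      where
      cover : ∀ {w} → ⁅ a ∣ b ⁆ w → X w ⊎ ⁅ y ⁆ w
      cover w∈ab with ab⊆xy w∈ab
      ... | inj₁ refl = inj₁ Xx
      ... | inj₂ refl = inj₂ refl
    b≢a : b ≢ a
    b≢a = a≢b ∘ sym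
    removes-both : ∀ {X : VSet G} → X a → X b → Empty (⁅ a ∣ b ⁆ ∖ X)
    removes-both Xa Xb = ∖-empty [ (λ { refl → Xa }) , (λ { refl → Xb }) ]
    option : (m : Move G ⁅ a ∣ b ⁆) → ∃ λ h → HasGrundy G (after G ⁅ a ∣ b ⁆ m) h × h ≢ 2
    option (one _ (inj₁ refl) _) = 1 , leaves ≐-refl refl b≢a , λ ()
    option (one _ (inj₂ refl) _) = 1 , leaves ⁅∣⁆-comm refl a≢b , λ ()
    option (two _ _ (inj₁ refl) (inj₁ refl) _ _) = 1 , leaves ≐-refl (inj₁ refl) [ b≢a , b≢a ] , λ ()
    option (two _ _ (inj₂ refl) (inj₂ refl) _ _) = 1 , leaves ⁅∣⁆-comm (inj₁ refl) [ a≢b , a≢b ] , λ ()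
    option (two _ _ (inj₁ refl) (inj₂ refl) _ _) =
      0 , HasGrundy-empty (removes-both (inj₁ refl) (inj₂ refl)) , λ ()
    option (two _ _ (inj₂ refl) (inj₁ refl) _ _) =
      0 , HasGrundy-empty (removes-both (inj₂ refl) (inj₁ refl)) , λ ()
    mex : ∀ h → h < 2 → ∃ λ m → HasGrundy G (after G ⁅ a ∣ b ⁆ m) h
    mex zero _ = two a b (inj₁ refl) (inj₂ refl) eab (ConnectedOrEmpty-empty (∖-empty Reach-target))
               , HasGrundy-empty (removes-both (inj₁ refl) (inj₂ refl))
    mex (suc zero) _ = one a (inj₁ refl)
                           (ConnectedOrEmpty-⊆⁅⁆ {a = b} λ (r , w≢a) → [ ⊥-elim ∘ w≢a , id ] (Reach-target r))
                     , leaves ≐-refl refl b≢a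
    mex (suc (suc _)) (s≤s (s≤s ()))

row : Bool → ℕ → ℕ
row b j = if b then evenRow j else oddRow j

evenRow≢oddRow : ∀ j → evenRow j ≢ oddRow j
evenRow≢oddRow 0 ()
evenRow≢oddRow 1 ()
evenRow≢oddRow 2 ()
evenRow≢oddRow 3 ()
evenRow≢oddRow 4 ()
evenRow≢oddRow 5 ()
evenRow≢oddRow (suc (suc j@(suc (suc (suc (suc _)))))) = evenRow≢oddRow j

row-j≢row-1+j : ∀ b j → row b j ≢ row b (suc j)
row-j≢row-1+j true 0 ()
row-j≢row-1+j true 1 ()
row-j≢row-1+j true 2 ()
row-j≢row-1+j true 3 ()
row-j≢row-1+j true 4 ()
row-j≢row-1+j true 5 ()
row-j≢row-1+j false 0 ()
row-j≢row-1+j false 1 ()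
row-j≢row-1+j false 2 ()
row-j≢row-1+j false 3 ()
row-j≢row-1+j false 4 ()
row-j≢row-1+j false 5 ()
row-j≢row-1+j b (suc (suc j@(suc (suc (suc (suc _)))))) = row-j≢row-1+j b j

row-j≢row′-1+j : ∀ b j → row b j ≢ row (not b) (suc j)
row-j≢row′-1+j true 0 ()
row-j≢row′-1+j true 1 ()
row-j≢row′-1+j true 2 ()
row-j≢row′-1+j true 3 ()
row-j≢row′-1+j true 4 ()
row-j≢row′-1+j true 5 ()
row-j≢row′-1+j false 0 ()
row-j≢row′-1+j false 1 ()
row-j≢row′-1+j false 2 ()
row-j≢row′-1+j false 3 ()
row-j≢row′-1+j false 4 ()
row-j≢row′-1+j false 5 ()
row-j≢row′-1+j b (suc (suc j@(suc (suc (suc (suc _)))))) = row-j≢row′-1+j b j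

table-i≢table-1+i : ∀ i j → j ≤ i → table i j ≢ table (suc i) j
table-i≢table-1+i 0 0 _ ()
table-i≢table-1+i 1 0 _ ()
table-i≢table-1+i 1 1 _ ()
table-i≢table-1+i 2 0 _ ()
table-i≢table-1+i 2 1 _ ()
table-i≢table-1+i 2 2 _ ()
table-i≢table-1+i 3 0 _ ()
table-i≢table-1+i 3 1 _ ()
table-i≢table-1+i 3 2 _ ()
table-i≢table-1+i 3 3 _ ()
table-i≢table-1+i 1 (suc (suc _)) (s≤s ())
table-i≢table-1+i 2 (suc (suc (suc _))) (s≤s (s≤s ()))
table-i≢table-1+i 3 (suc (suc (suc (suc _)))) (s≤s (s≤s (s≤s ())))
table-i≢table-1+i (suc (suc (suc (suc x)))) j _ = large x
  where
  large : ∀ x → table (4 + x) j ≢ table (5 + x) j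
  large 0 = evenRow≢oddRow j
  large 1 = λ eq → evenRow≢oddRow j (sym eq)
  large (suc (suc x)) = large x

table-j≢table-1+j : ∀ i j → suc j ≤ i → table i j ≢ table i (suc j)
table-j≢table-1+j 1 0 _ ()
table-j≢table-1+j 2 0 _ ()
table-j≢table-1+j 2 1 _ ()
table-j≢table-1+j 3 0 _ ()
table-j≢table-1+j 3 1 _ ()
table-j≢table-1+j 3 2 _ ()
table-j≢table-1+j 1 (suc _) (s≤s ())
table-j≢table-1+j 2 (suc (suc _)) (s≤s (s≤s ()))
table-j≢table-1+j 3 (suc (suc (suc _))) (s≤s (s≤s (s≤s ())))
table-j≢table-1+j (suc (suc (suc (suc x)))) j _ = row-j≢row-1+j (isEven x) j

table-ij≢table-1+i-1+j : ∀ i j → j ≤ i → table i j ≢ table (suc i) (suc j)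
table-ij≢table-1+i-1+j 0 0 _ ()
table-ij≢table-1+i-1+j 1 0 _ ()
table-ij≢table-1+i-1+j 1 1 _ ()
table-ij≢table-1+i-1+j 2 0 _ ()
table-ij≢table-1+i-1+j 2 1 _ ()
table-ij≢table-1+i-1+j 2 2 _ ()
table-ij≢table-1+i-1+j 3 0 _ ()
table-ij≢table-1+i-1+j 3 1 _ ()
table-ij≢table-1+i-1+j 3 2 _ ()
table-ij≢table-1+i-1+j 3 3 _ ()
table-ij≢table-1+i-1+j 1 (suc (suc _)) (s≤s ())
table-ij≢table-1+i-1+j 2 (suc (suc (suc _))) (s≤s (s≤s ()))
table-ij≢table-1+i-1+j 3 (suc (suc (suc (suc _)))) (s≤s (s≤s (s≤s ())))
table-ij≢table-1+i-1+j (suc (suc (suc (suc x)))) j _ = large x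
  where
  large : ∀ x → table (4 + x) j ≢ table (5 + x) (suc j)
  large 0 = row-j≢row′-1+j true j
  large 1 = row-j≢row′-1+j false j
  large (suc (suc x)) = large x

-- Some move from a star with i nonempty legs, j of them with two vertices, reaches a position of value h.
data TableOption : ℕ → ℕ → ℕ → Set where
  dropShort   : ∀ {i j h} → j ≤ i → table i j ≡ h → TableOption (suc i) j h
  trimLong    : ∀ {i j h} → table i j ≡ h → TableOption i (suc j) h
  dropLong    : ∀ {i j h} → table i j ≡ h → TableOption (suc i) (suc j) h
  clearSingle : TableOption 0 0 0
  clearEdge   : TableOption 1 0 0

TableOption-shiftᵢ : ∀ {i j h} → TableOption (6 + i) j h → TableOption (8 + i) j h
TableOption-shiftᵢ (dropShort j≤i refl) = dropShort (m≤n⇒m≤1+n (m≤n⇒m≤1+n j≤i)) refl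
TableOption-shiftᵢ (trimLong refl) = trimLong refl
TableOption-shiftᵢ (dropLong refl) = dropLong refl

TableOption-shiftᵢⱼ : ∀ {i j h} → TableOption (6 + i) (5 + j) h → TableOption (8 + i) (7 + j) h
TableOption-shiftᵢⱼ (dropShort j≤i refl) = dropShort (s≤s (s≤s j≤i)) refl
TableOption-shiftᵢⱼ (trimLong refl) = trimLong refl
TableOption-shiftᵢⱼ (dropLong refl) = dropLong refl

TableMex : ℕ → Set
TableMex i = ∀ j → j ≤ i → (h : Fin (table i j)) → TableOption i j (toℕ h)

-- From i = 4 on the table has period 2 in i, and from j = 4 on also in j.
TableMex-periodic : ∀ x → TableMex (6 + x) → TableMex (8 + x)
TableMex-periodic x mex j j≤8+x h with j ≤? 6
... | yes j≤6 = TableOption-shiftᵢ (mex j (≤-trans j≤6 (m≤m+n 6 x)) h)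
... | no j≰6 with o , refl ← m≤n⇒∃[o]m+o≡n (≰⇒> j≰6) =
  TableOption-shiftᵢⱼ (mex (5 + o) (≤-pred (≤-pred j≤8+x)) h)

table-mex : ∀ i → TableMex i
table-mex 0 0 _ fzero = clearSingle
table-mex 1 0 _ fzero = clearEdge
table-mex 1 0 _ (fsuc fzero) = dropShort z≤n refl
table-mex 2 1 _ fzero = dropShort (s≤s z≤n) refl
table-mex 2 2 _ fzero = dropLong refl
table-mex 2 2 _ (fsuc fzero) = trimLong refl
table-mex 3 0 _ fzero = dropShort z≤n refl
table-mex 3 1 _ fzero = dropLong refl
table-mex 3 1 _ (fsuc fzero) = dropShort (s≤s z≤n) refl
table-mex 3 3 _ fzero = trimLong refl
table-mex 4 1 _ fzero = trimLong refl
table-mex 4 1 _ (fsuc fzero) = dropLong refl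
table-mex 4 1 _ (fsuc (fsuc fzero)) = dropShort (s≤s z≤n) refl
table-mex 4 2 _ fzero = dropShort (s≤s (s≤s z≤n)) refl
table-mex 4 3 _ fzero = dropLong refl
table-mex 4 3 _ (fsuc fzero) = dropShort (s≤s (s≤s (s≤s z≤n))) refl
table-mex 5 0 _ fzero = dropShort z≤n refl
table-mex 5 1 _ fzero = dropLong refl
table-mex 5 1 _ (fsuc fzero) = trimLong refl
table-mex 5 3 _ fzero = trimLong refl
table-mex 5 3 _ (fsuc fzero) = dropLong refl
table-mex 5 3 _ (fsuc (fsuc fzero)) = dropShort (s≤s (s≤s (s≤s z≤n))) refl
table-mex 5 4 _ fzero = dropShort (s≤s (s≤s (s≤s (s≤s z≤n)))) refl
table-mex 5 5 _ fzero = dropLong refl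
table-mex 5 5 _ (fsuc fzero) = trimLong refl
table-mex 6 1 _ fzero = trimLong refl
table-mex 6 1 _ (fsuc fzero) = dropLong refl
table-mex 6 1 _ (fsuc (fsuc fzero)) = dropShort (s≤s z≤n) refl
table-mex 6 2 _ fzero = dropShort (s≤s (s≤s z≤n)) refl
table-mex 6 3 _ fzero = dropLong refl
table-mex 6 3 _ (fsuc fzero) = trimLong refl
table-mex 6 5 _ fzero = trimLong refl
table-mex 6 5 _ (fsuc fzero) = dropLong refl
table-mex 6 5 _ (fsuc (fsuc fzero)) = dropShort (s≤s (s≤s (s≤s (s≤s (s≤s z≤n))))) refl
table-mex 7 0 _ fzero = dropShort z≤n refl
table-mex 7 1 _ fzero = dropLong refl
table-mex 7 1 _ (fsuc fzero) = trimLong refl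
table-mex 7 3 _ fzero = trimLong refl
table-mex 7 3 _ (fsuc fzero) = dropLong refl
table-mex 7 3 _ (fsuc (fsuc fzero)) = dropShort (s≤s (s≤s (s≤s z≤n))) refl
table-mex 7 4 _ fzero = dropShort (s≤s (s≤s (s≤s (s≤s z≤n)))) refl
table-mex 7 5 _ fzero = dropLong refl
table-mex 7 5 _ (fsuc fzero) = trimLong refl
table-mex 7 6 _ fzero = dropShort (s≤s (s≤s (s≤s (s≤s (s≤s (s≤s z≤n)))))) refl
table-mex 7 7 _ fzero = dropLong refl
table-mex 7 7 _ (fsuc fzero) = trimLong refl
table-mex 2 (suc (suc (suc _))) (s≤s (s≤s ()))
table-mex 3 (suc (suc (suc (suc _)))) (s≤s (s≤s (s≤s ())))
table-mex 4 (suc (suc (suc (suc (suc _))))) (s≤s (s≤s (s≤s (s≤s ()))))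
table-mex 5 (suc (suc (suc (suc (suc (suc _)))))) (s≤s (s≤s (s≤s (s≤s (s≤s ())))))
table-mex 6 (suc (suc (suc (suc (suc (suc (suc _))))))) (s≤s (s≤s (s≤s (s≤s (s≤s (s≤s ()))))))
table-mex 7 (suc (suc (suc (suc (suc (suc (suc (suc _)))))))) (s≤s (s≤s (s≤s (s≤s (s≤s (s≤s (s≤s ())))))))
table-mex (suc (suc (suc (suc (suc (suc (suc (suc x)))))))) =
  TableMex-periodic x (table-mex (suc (suc (suc (suc (suc (suc x)))))))

table-i≤1≢j+i : ∀ {i j} → i ≤ 1 → j ≤ i → j + i ≢ table i j
table-i≤1≢j+i z≤n z≤n ()
table-i≤1≢j+i (s≤s z≤n) z≤n ()
table-i≤1≢j+i (s≤s z≤n) (s≤s z≤n) ()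

table-1+i≢j+i : ∀ {i j} → i ≤ 1 → j ≤ i → j + i ≢ table (suc i) j
table-1+i≢j+i z≤n z≤n ()
table-1+i≢j+i (s≤s z≤n) z≤n ()
table-1+i≢j+i (s≤s z≤n) (s≤s z≤n) ()

∑ : ∀ {k} → (Fin k → ℕ) → ℕ
∑ {zero} _ = 0
∑ {suc k} g = g fzero + ∑ (g ∘ fsuc)

_[_]≔_ : ∀ {k} → (Fin k → ℕ) → Fin k → ℕ → Fin k → ℕ
g [ p ]≔ b = updateAt g p (const b)

[]≔-same : ∀ {k} (g : Fin k → ℕ) p b → (g [ p ]≔ b) p ≡ b
[]≔-same g p b = updateAt-updates p g

[]≔-other : ∀ {k} {g : Fin k → ℕ} {p q b} → q ≢ p → (g [ p ]≔ b) q ≡ g q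
[]≔-other {g = g} {p} {q} {b} q≢p = updateAt-minimal q p {const b} g q≢p

∑-cong : ∀ {k} {g h : Fin k → ℕ} → g ≗ h → ∑ g ≡ ∑ h
∑-cong {zero} _ = refl
∑-cong {suc k} g≗h = cong₂ _+_ (g≗h fzero) (∑-cong (g≗h ∘ fsuc))

∑-mono-≤ : ∀ {k} {g h : Fin k → ℕ} → (∀ q → g q ≤ h q) → ∑ g ≤ ∑ h
∑-mono-≤ {zero} _ = z≤n
∑-mono-≤ {suc k} g≤h = +-mono-≤ (g≤h fzero) (∑-mono-≤ (g≤h ∘ fsuc))

∑-const : ∀ k c → ∑ {k} (const c) ≡ k * c
∑-const zero c = refl
∑-const (suc k) c = cong (c +_) (∑-const k c)

∑≡0⇒≡0 : ∀ {k} (g : Fin k → ℕ) → ∑ g ≡ 0 → ∀ q → g q ≡ 0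
∑≡0⇒≡0 g ∑g≡0 fzero = m+n≡0⇒m≡0 (g fzero) ∑g≡0
∑≡0⇒≡0 g ∑g≡0 (fsuc q) = ∑≡0⇒≡0 (g ∘ fsuc) (m+n≡0⇒n≡0 (g fzero) ∑g≡0) q

∑-<⇒ : ∀ {k} (g h : Fin k → ℕ) → ∑ g < ∑ h → ∃ λ q → g q < h q
∑-<⇒ {zero} g h ()
∑-<⇒ {suc k} g h ∑g<∑h with g fzero <? h fzero
... | yes g₀<h₀ = fzero , g₀<h₀
... | no g₀≮h₀
  with q , gq<hq ← ∑-<⇒ (g ∘ fsuc) (h ∘ fsuc)
                        (+-cancelˡ-< (g fzero) _ _ (<-≤-trans ∑g<∑h (+-monoˡ-≤ _ (≮⇒≥ g₀≮h₀))))
  = fsuc q , gq<hq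

∑-[]≔ : ∀ {k} (g : Fin k → ℕ) p b → g p + ∑ (g [ p ]≔ b) ≡ b + ∑ g
∑-[]≔ {suc k} g fzero b = x∙yz≈y∙xz (g fzero) b _
∑-[]≔ {suc k} g (fsuc p) b = begin
  g (fsuc p) + (g fzero + ∑ ((g ∘ fsuc) [ p ]≔ b)) ≡⟨ x∙yz≈y∙xz (g (fsuc p)) (g fzero) _ ⟩
  g fzero + (g (fsuc p) + ∑ ((g ∘ fsuc) [ p ]≔ b)) ≡⟨ cong (g fzero +_) (∑-[]≔ (g ∘ fsuc) p b) ⟩
  g fzero + (b + ∑ (g ∘ fsuc))                     ≡⟨ x∙yz≈y∙xz (g fzero) b _ ⟩
  b + (g fzero + ∑ (g ∘ fsuc))                     ∎
  where open ≡-Reasoning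

∑∘[]≔ : ∀ {k} (f : ℕ → ℕ) (g : Fin k → ℕ) p b → f (g p) + ∑ (f ∘ (g [ p ]≔ b)) ≡ f b + ∑ (f ∘ g)
∑∘[]≔ f g p b =
  trans (cong (f (g p) +_) (∑-cong (map-updateAt-local {f = f} {g = const b} {h = const (f b)} g p refl)))
        (∑-[]≔ (f ∘ g) p (f b))

∑∘[]≔-at : ∀ {k} (f : ℕ → ℕ) (g : Fin k → ℕ) p b {x} → g p ≡ x → f x + ∑ (f ∘ (g [ p ]≔ b)) ≡ f b + ∑ (f ∘ g)
∑∘[]≔-at f g p b refl = ∑∘[]≔ f g p b

∑-[]≔-< : ∀ {k} (g : Fin k → ℕ) p b → b < g p → ∑ (g [ p ]≔ b) < ∑ g
∑-[]≔-< g p b b<gp = +-cancelˡ-< (g p) _ _ (subst (_< g p + ∑ g) (sym (∑-[]≔ g p b)) (+-monoˡ-< (∑ g) b<gp))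


∑-pos⇒ : ∀ {k} (g : Fin k → ℕ) → 0 < ∑ g → ∃ λ q → 0 < g q
∑-pos⇒ {k} g 0<∑g = ∑-<⇒ (const 0) g (subst (_< ∑ g) (sym (trans (∑-const k 0) (*-zeroʳ k))) 0<∑g)

𝟙[>0] : ℕ → ℕ
𝟙[>0] zero = 0
𝟙[>0] (suc _) = 1

𝟙[≡2] : ℕ → ℕ
𝟙[≡2] x = if x ≡ᵇ 2 then 1 else 0

𝟙[≡2]≤𝟙[>0] : ∀ x → 𝟙[≡2] x ≤ 𝟙[>0] x
𝟙[≡2]≤𝟙[>0] 0 = z≤n
𝟙[≡2]≤𝟙[>0] 1 = z≤n
𝟙[≡2]≤𝟙[>0] 2 = s≤s z≤n
𝟙[≡2]≤𝟙[>0] (suc (suc (suc _))) = z≤n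

𝟙[>0]-1 : ∀ {x} → 1 ≤ x → 𝟙[>0] x ≡ 1
𝟙[>0]-1 (s≤s _) = refl

𝟙[>0]≡0⇒ : ∀ {x} → 𝟙[>0] x ≡ 0 → x ≡ 0
𝟙[>0]≡0⇒ {zero} _ = refl

1≤x≤2⇒ : ∀ {x} → 1 ≤ x → x ≤ 2 → x ≡ 1 ⊎ x ≡ 2
1≤x≤2⇒ (s≤s z≤n) (s≤s z≤n) = inj₁ refl
1≤x≤2⇒ (s≤s z≤n) (s≤s (s≤s z≤n)) = inj₂ refl

x<2⇒ : ∀ {x} → x < 2 → x ≡ 0 ⊎ x ≡ 1
x<2⇒ (s≤s x≤1) = n≤1⇒n≡0∨n≡1 x≤1

module Star {k : ℕ} {ℓ : Fin k → ℕ} (ℓ≤2 : ∀ p → ℓ p ≤ 2) where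

  G : Graph
  G = star k ℓ

  open Positions G

  centre : V G
  centre = inj₁ tt

  Lengths : Set
  Lengths = Fin k → ℕ

  Fits : Lengths → Set
  Fits n = ∀ p → n p ≤ ℓ p

  Truncated : Lengths → VSet G
  Truncated n (inj₁ _) = ⊤
  Truncated n (inj₂ (p , t)) = toℕ t < n p

  Centreless : Lengths → VSet G
  Centreless n = Truncated n ∖ ⁅ centre ⁆

  legs : Lengths → ℕ
  legs n = ∑ (𝟙[>0] ∘ n)

  longLegs : Lengths → ℕ
  longLegs n = ∑ (𝟙[≡2] ∘ n)

  value : Lengths → ℕ
  value n = table (legs n) (longLegs n)

  vertexAt : ∀ p m → m < ℓ p → ∃ λ (t : Fin (ℓ p)) → toℕ t ≡ m
  vertexAt p m m<ℓp = fromℕ< m<ℓp , toℕ-fromℕ< m<ℓp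

  leg-≡ : ∀ {p} {t t′ : Fin (ℓ p)} → toℕ t ≡ toℕ t′ → _≡_ {A = V G} (inj₂ (p , t)) (inj₂ (p , t′))
  leg-≡ t≡t′ = cong (λ t → inj₂ (_ , t)) (toℕ-injective t≡t′)

  base∈ : ∀ {m p} {t : Fin (ℓ p)} → toℕ t ≡ 0 → 1 ≤ m → toℕ t < m
  base∈ t≡0 1≤m = subst (_< _) (sym t≡0) 1≤m

  tip∈ : ∀ {m p} {t : Fin (ℓ p)} → toℕ t ≡ 1 → m ≡ 2 → toℕ t < m
  tip∈ t≡1 refl = subst (_< 2) (sym t≡1) ≤-refl

  StarE-sym : ∀ {x y} → E G x y → E G y x
  StarE-sym (c-p p t e) = p-c p t e
  StarE-sym (p-c p t e) = c-p p t e
  StarE-sym (p-p p t t′ e) = p-p' p t t′ e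
  StarE-sym (p-p' p t t′ e) = p-p p t t′ e

  reaches-centre : ∀ n p m (t : Fin (ℓ p)) → toℕ t ≡ m → toℕ t < n p →
                   Reach G (Truncated n) (inj₂ (p , t)) centre
  reaches-centre n p zero t t≡0 t<np = step t<np (p-c p t t≡0) (here tt)
  reaches-centre n p (suc m) t t≡1+m t<np
    with t′ , t′≡m ← vertexAt p m (<⇒≤ (subst (_< ℓ p) t≡1+m (toℕ<n t))) =
    step t<np (p-p' p t′ t (trans (cong suc t′≡m) (sym t≡1+m)))
         (reaches-centre n p m t′ t′≡m (subst (_< n p) (sym t′≡m) (<⇒≤ (subst (_< n p) t≡1+m t<np))))

  Truncated-connected : ∀ n → ConnectedOrEmpty G (Truncated n)
  Truncated-connected n u v u∈ v∈ = Reach-trans (to-centre u u∈) (Reach-sym StarE-sym (to-centre v v∈))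
    where
    to-centre : ∀ w → Truncated n w → Reach G (Truncated n) w centre
    to-centre (inj₁ tt) _ = here tt
    to-centre (inj₂ (p , t)) t<np = reaches-centre n p (toℕ t) t refl t<np

  legal⇒connected : ∀ {n u} X → Truncated n u →
                    ConnectedOrEmpty G (Component G (Truncated n) u ∖ X) →
                    ConnectedOrEmpty G (Truncated n ∖ X)
  legal⇒connected X u∈ = ConnectedOrEmpty-resp-≐ (Component-∖ X (Truncated-connected _) u∈)

  connected⇒legal : ∀ {n u} X → Truncated n u →
                    ConnectedOrEmpty G (Truncated n ∖ X) →
                    ConnectedOrEmpty G (Component G (Truncated n) u ∖ X)
  connected⇒legal X u∈ = ConnectedOrEmpty-resp-≐ (≐-sym (Component-∖ X (Truncated-connected _) u∈))

  []≔-fits : ∀ {n} p b → b ≤ n p → Fits n → Fits (n [ p ]≔ b)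
  []≔-fits {n} p b b≤np fits q with q ≟ p
  ... | yes refl = subst (_≤ ℓ q) (sym ([]≔-same n q b)) (≤-trans b≤np (fits q))
  ... | no q≢p = subst (_≤ ℓ q) (sym ([]≔-other q≢p)) (fits q)

  base : ∀ {n} → Fits n → ∀ p → 1 ≤ n p → ∃ λ (t : Fin (ℓ p)) → toℕ t ≡ 0
  base fits p 1≤np = vertexAt p 0 (≤-trans 1≤np (fits p))

  tip : ∀ {n} → Fits n → ∀ p → n p ≡ 2 → ∃ λ (t : Fin (ℓ p)) → toℕ t ≡ 1
  tip fits p np≡2 = vertexAt p 1 (subst (_≤ ℓ _) np≡2 (fits p))

  base≢tip : ∀ {p} {t₀ t₁ : Fin (ℓ p)} → toℕ t₀ ≡ 0 → toℕ t₁ ≡ 1 →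
             _≢_ {A = V G} (inj₂ (p , t₀)) (inj₂ (p , t₁))
  base≢tip t₀≡0 t₁≡1 refl = contradiction (trans (sym t₀≡0) t₁≡1) λ ()

  on-short-leg : ∀ {m p} {t₀ : Fin (ℓ p)} → m ≡ 1 → toℕ t₀ ≡ 0 → ∀ t → toℕ t < m →
                 ⁅ inj₂ (p , t₀) ⁆ (inj₂ (p , t))
  on-short-leg refl t₀≡0 t t<1 = leg-≡ (trans (n<1⇒n≡0 t<1) (sym t₀≡0))

  on-long-leg : ∀ {m p} {t₀ t₁ : Fin (ℓ p)} → m ≡ 2 → toℕ t₀ ≡ 0 → toℕ t₁ ≡ 1 → ∀ t → toℕ t < m →
                ⁅ inj₂ (p , t₀) ∣ inj₂ (p , t₁) ⁆ (inj₂ (p , t))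
  on-long-leg refl t₀≡0 t₁≡1 t t<2 =
    [ (λ t≡0 → inj₁ (leg-≡ (trans t≡0 (sym t₀≡0)))) , (λ t≡1 → inj₂ (leg-≡ (trans t≡1 (sym t₁≡1)))) ]
    (x<2⇒ t<2)

  Truncated-∖-tail : ∀ n p b (X : VSet G) → b ≤ n p → ¬ X centre →
                     (∀ {q t} → X (inj₂ (q , t)) → q ≡ p × b ≤ toℕ t) →
                     (∀ t → b ≤ toℕ t → toℕ t < n p → X (inj₂ (p , t))) →
                     Truncated n ∖ X ≐ Truncated (n [ p ]≔ b)
  Truncated-∖-tail n p b X b≤np ¬Xc X⇒tail tail⇒X = to , from
    where
    to : Truncated n ∖ X ⊆ Truncated (n [ p ]≔ b)
    to {inj₁ _} _ = tt
    to {inj₂ (q , t)} (t<nq , ¬Xt) with q ≟ p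
    ... | yes refl = subst (toℕ t <_) (sym ([]≔-same n p b)) (≰⇒> λ b≤t → ¬Xt (tail⇒X t b≤t t<nq))
    ... | no q≢p = subst (toℕ t <_) (sym ([]≔-other q≢p)) t<nq
    from : Truncated (n [ p ]≔ b) ⊆ Truncated n ∖ X
    from {inj₁ _} _ = tt , ¬Xc
    from {inj₂ (q , t)} t<n′q with q ≟ p
    ... | yes refl = <-≤-trans t<b b≤np , λ Xt → <⇒≱ t<b (proj₂ (X⇒tail Xt))
      where
      t<b : toℕ t < b
      t<b = subst (toℕ t <_) ([]≔-same n p b) t<n′q
    ... | no q≢p = subst (toℕ t <_) ([]≔-other q≢p) t<n′q , λ Xt → q≢p (proj₁ (X⇒tail Xt))

  Truncated-∖-leaf : ∀ n p (t : Fin (ℓ p)) → n p ≡ 1 → toℕ t ≡ 0 →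
                     Truncated n ∖ ⁅ inj₂ (p , t) ⁆ ≐ Truncated (n [ p ]≔ 0)
  Truncated-∖-leaf n p t np≡1 t≡0 =
    Truncated-∖-tail n p 0 _ z≤n (λ ()) (λ { refl → refl , z≤n }) λ t′ _ → on-short-leg np≡1 t≡0 t′

  Truncated-∖-tip : ∀ n p (t : Fin (ℓ p)) → n p ≡ 2 → toℕ t ≡ 1 →
                    Truncated n ∖ ⁅ inj₂ (p , t) ⁆ ≐ Truncated (n [ p ]≔ 1)
  Truncated-∖-tip n p t np≡2 t≡1 =
    Truncated-∖-tail n p 1 _ (subst (1 ≤_) (sym np≡2) (s≤s z≤n)) (λ ())
                     (λ { refl → refl , ≤-reflexive (sym t≡1) })
    λ t′ 1≤t′ t′<np → leg-≡ (trans (≤-antisym (≤-pred (subst (toℕ t′ <_) np≡2 t′<np)) 1≤t′) (sym t≡1))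

  Truncated-∖-leg : ∀ n p (t₀ t₁ : Fin (ℓ p)) → n p ≡ 2 → toℕ t₀ ≡ 0 → toℕ t₁ ≡ 1 →
                    Truncated n ∖ ⁅ inj₂ (p , t₀) ∣ inj₂ (p , t₁) ⁆ ≐ Truncated (n [ p ]≔ 0)
  Truncated-∖-leg n p t₀ t₁ np≡2 t₀≡0 t₁≡1 =
    Truncated-∖-tail n p 0 _ z≤n [ (λ ()) , (λ ()) ]
                     (λ { (inj₁ refl) → refl , z≤n ; (inj₂ refl) → refl , z≤n })
    λ t _ → on-long-leg np≡2 t₀≡0 t₁≡1 t

  OnLeg : Fin k → VSet G
  OnLeg p (inj₁ _) = ⊥
  OnLeg p (inj₂ (q , _)) = q ≡ p

  Reach-onLeg : ∀ {S p u v} → ¬ S centre → Reach G S u v → OnLeg p u → OnLeg p v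
  Reach-onLeg {S} {p} ¬Sc = Reach-invariant (OnLeg p) preserve
    where
    preserve : ∀ {x y} → S x → S y → E G x y → OnLeg p x → OnLeg p y
    preserve _ _ (c-p _ _ _) ()
    preserve _ Sc (p-c _ _ _) _ = ⊥-elim (¬Sc Sc)
    preserve _ _ (p-p _ _ _ _) q≡p = q≡p
    preserve _ _ (p-p' _ _ _ _) q≡p = q≡p

  PastBase : Fin k → VSet G
  PastBase p (inj₁ _) = ⊥
  PastBase p (inj₂ (q , t)) = q ≡ p × 1 ≤ toℕ t

  ¬Reach-centre : ∀ {S p} (t₀ : Fin (ℓ p)) → toℕ t₀ ≡ 0 → ¬ S (inj₂ (p , t₀)) →
                  ∀ {u} → PastBase p u → ¬ Reach G S u centre
  ¬Reach-centre {S} {p} t₀ t₀≡0 ¬St₀ past r = Reach-invariant (PastBase p) preserve r past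
    where
    preserve : ∀ {x y} → S x → S y → E G x y → PastBase p x → PastBase p y
    preserve _ _ (c-p _ _ _) ()
    preserve _ _ (p-c _ t t≡0) (_ , 1≤t) = contradiction (subst (1 ≤_) t≡0 1≤t) λ ()
    preserve _ _ (p-p _ a b 1+a≡b) (q≡p , _) = q≡p , subst (1 ≤_) 1+a≡b (s≤s z≤n)
    preserve _ Sy (p-p' _ a b 1+a≡b) (refl , _) with toℕ a in a≡
    ... | zero = ⊥-elim (¬St₀ (subst S (leg-≡ (trans a≡ (sym t₀≡0))) Sy))
    ... | suc _ = refl , s≤s z≤n

  longLegs≤legs : ∀ n → longLegs n ≤ legs n
  longLegs≤legs n = ∑-mono-≤ (𝟙[≡2]≤𝟙[>0] ∘ n)

  legs-[]≔0 : ∀ n p → 1 ≤ n p → legs n ≡ suc (legs (n [ p ]≔ 0))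
  legs-[]≔0 n p 1≤np = sym (subst (λ x → x + legs (n [ p ]≔ 0) ≡ legs n) (𝟙[>0]-1 1≤np) (∑∘[]≔ 𝟙[>0] n p 0))

  dropShort-counts : ∀ n p → n p ≡ 1 → legs n ≡ suc (legs (n [ p ]≔ 0)) × longLegs n ≡ longLegs (n [ p ]≔ 0)
  dropShort-counts n p np≡1 =
    legs-[]≔0 n p (≤-reflexive (sym np≡1)) , sym (∑∘[]≔-at 𝟙[≡2] n p 0 np≡1)

  trimLong-counts : ∀ n p → n p ≡ 2 → legs n ≡ legs (n [ p ]≔ 1) × longLegs n ≡ suc (longLegs (n [ p ]≔ 1))
  trimLong-counts n p np≡2 =
    sym (suc-injective (∑∘[]≔-at 𝟙[>0] n p 1 np≡2)) ,
    sym (∑∘[]≔-at 𝟙[≡2] n p 1 np≡2)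

  dropLong-counts : ∀ n p → n p ≡ 2 →
                    legs n ≡ suc (legs (n [ p ]≔ 0)) × longLegs n ≡ suc (longLegs (n [ p ]≔ 0))
  dropLong-counts n p np≡2 =
    legs-[]≔0 n p (subst (1 ≤_) (sym np≡2) (s≤s z≤n)) , sym (∑∘[]≔-at 𝟙[≡2] n p 0 np≡2)

  nonemptyLeg : ∀ n → 1 ≤ legs n → ∃ λ p → 1 ≤ n p
  nonemptyLeg n 1≤legs with p , 0<𝟙 ← ∑-pos⇒ (𝟙[>0] ∘ n) 1≤legs = p , positive (n p) 0<𝟙
    where
    positive : ∀ x → 0 < 𝟙[>0] x → 1 ≤ x
    positive (suc _) _ = s≤s z≤n

  longLeg : ∀ n → 1 ≤ longLegs n → ∃ λ p → n p ≡ 2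
  longLeg n 1≤longLegs with p , 0<𝟙 ← ∑-pos⇒ (𝟙[≡2] ∘ n) 1≤longLegs = p , is-2 (n p) 0<𝟙
    where
    is-2 : ∀ x → 0 < 𝟙[≡2] x → x ≡ 2
    is-2 2 _ = refl
    is-2 0 ()
    is-2 1 ()
    is-2 (suc (suc (suc _))) ()

  shortLeg : ∀ n → Fits n → longLegs n < legs n → ∃ λ p → n p ≡ 1
  shortLeg n fits longLegs<legs with p , 𝟙<𝟙 ← ∑-<⇒ (𝟙[≡2] ∘ n) (𝟙[>0] ∘ n) longLegs<legs =
    p , is-1 (≤-trans (fits p) (ℓ≤2 p)) 𝟙<𝟙
    where
    is-1 : ∀ {x} → x ≤ 2 → 𝟙[≡2] x < 𝟙[>0] x → x ≡ 1
    is-1 {1} _ _ = refl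
    is-1 {0} _ ()
    is-1 {2} _ (s≤s ())
    is-1 {suc (suc (suc _))} (s≤s (s≤s ())) _

  otherLeg : ∀ n p → 1 ≤ n p → 2 ≤ legs n → ∃ λ q → q ≢ p × 1 ≤ n q
  otherLeg n p 1≤np 2≤legs =
    other (nonemptyLeg (n [ p ]≔ 0) (≤-pred (subst (2 ≤_) (legs-[]≔0 n p 1≤np) 2≤legs)))
    where
    other : (∃ λ q → 1 ≤ (n [ p ]≔ 0) q) → ∃ λ q → q ≢ p × 1 ≤ n q
    other (q , 1≤n′q) with q ≟ p
    ... | yes refl = contradiction (subst (1 ≤_) ([]≔-same n p 0) 1≤n′q) λ ()
    ... | no q≢p = q , q≢p , subst (1 ≤_) ([]≔-other q≢p) 1≤n′q

  legs≡0⇒ : ∀ n → legs n ≡ 0 → ∀ q → n q ≡ 0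
  legs≡0⇒ n legs≡0 q = 𝟙[>0]≡0⇒ (∑≡0⇒≡0 (𝟙[>0] ∘ n) legs≡0 q)

  legs≡1⇒others≡0 : ∀ n p → 1 ≤ n p → legs n ≡ 1 → legs (n [ p ]≔ 0) ≡ 0
  legs≡1⇒others≡0 n p 1≤np legs≡1 = suc-injective (trans (sym (legs-[]≔0 n p 1≤np)) legs≡1)

  onlyLeg : ∀ n p → 1 ≤ n p → legs n ≡ 1 → ∀ q → q ≢ p → n q ≡ 0
  onlyLeg n p 1≤np legs≡1 q q≢p =
    trans (sym ([]≔-other q≢p)) (legs≡0⇒ (n [ p ]≔ 0) (legs≡1⇒others≡0 n p 1≤np legs≡1) q)

  onlyLeg-longLegs : ∀ n p → 1 ≤ n p → legs n ≡ 1 → longLegs n ≡ 𝟙[≡2] (n p)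
  onlyLeg-longLegs n p 1≤np legs≡1 = begin
    longLegs n                            ≡⟨ sym (∑∘[]≔ 𝟙[≡2] n p 0) ⟩
    𝟙[≡2] (n p) + longLegs (n [ p ]≔ 0)   ≡⟨ cong (𝟙[≡2] (n p) +_) longLegs′≡0 ⟩
    𝟙[≡2] (n p) + 0                       ≡⟨ +-identityʳ _ ⟩
    𝟙[≡2] (n p)                           ∎
    where
    open ≡-Reasoning
    longLegs′≡0 : longLegs (n [ p ]≔ 0) ≡ 0
    longLegs′≡0 =
      n≤0⇒n≡0 (subst (longLegs (n [ p ]≔ 0) ≤_) (legs≡1⇒others≡0 n p 1≤np legs≡1) (longLegs≤legs _))

  otherLeg≢ : ∀ {p q} {t : Fin (ℓ p)} {s : Fin (ℓ q)} → q ≢ p → _≢_ {A = V G} (inj₂ (q , s)) (inj₂ (p , t))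
  otherLeg≢ q≢p refl = q≢p refl

  ¬Reach-otherLeg : ∀ {S p q} {t : Fin (ℓ p)} {s : Fin (ℓ q)} → ¬ S centre → q ≢ p →
                    ¬ Reach G S (inj₂ (p , t)) (inj₂ (q , s))
  ¬Reach-otherLeg ¬Sc q≢p r = q≢p (Reach-onLeg ¬Sc r refl)

  only-leg-cover : ∀ n p → (∀ q → q ≢ p → n q ≡ 0) → ∀ {w} → Truncated n w →
                   w ≡ centre ⊎ ∃ λ (t : Fin (ℓ p)) → w ≡ inj₂ (p , t) × toℕ t < n p
  only-leg-cover n p others {inj₁ tt} _ = inj₁ refl
  only-leg-cover n p others {inj₂ (q , t)} t<nq with q ≟ p
  ... | yes refl = inj₂ (t , refl , t<nq)
  ... | no q≢p = ⊥-elim (n≮0 (subst (toℕ t <_) (others q q≢p) t<nq))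

  Centreless-empty : ∀ n → legs n ≡ 0 → Empty (Centreless n)
  Centreless-empty n legs≡0 (inj₁ tt) (_ , c∉) = c∉ refl
  Centreless-empty n legs≡0 (inj₂ (q , t)) (t<nq , _) = n≮0 (subst (toℕ t <_) (legs≡0⇒ n legs≡0 q) t<nq)

  Centreless-shortLeg : ∀ n p (t₀ : Fin (ℓ p)) → n p ≡ 1 → toℕ t₀ ≡ 0 → (∀ q → q ≢ p → n q ≡ 0) →
                        Centreless n ≐ ⁅ inj₂ (p , t₀) ⁆
  Centreless-shortLeg n p t₀ np≡1 t₀≡0 others =
    ∖-≐ cover (λ { refl → base∈ t₀≡0 (≤-reflexive (sym np≡1)) }) λ { refl () }
    where
    cover : ∀ {w} → Truncated n w → ⁅ centre ⁆ w ⊎ ⁅ inj₂ (p , t₀) ⁆ w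
    cover w∈ with only-leg-cover n p others w∈
    ... | inj₁ w≡c = inj₁ w≡c
    ... | inj₂ (t , refl , t<np) = inj₂ (on-short-leg np≡1 t₀≡0 t t<np)

  Centreless-longLeg : ∀ n p (t₀ t₁ : Fin (ℓ p)) → n p ≡ 2 → toℕ t₀ ≡ 0 → toℕ t₁ ≡ 1 →
                       (∀ q → q ≢ p → n q ≡ 0) →
                       Centreless n ≐ ⁅ inj₂ (p , t₀) ∣ inj₂ (p , t₁) ⁆
  Centreless-longLeg n p t₀ t₁ np≡2 t₀≡0 t₁≡1 others =
    ∖-≐ cover (λ { (inj₁ refl) → base∈ t₀≡0 (subst (1 ≤_) (sym np≡2) (s≤s z≤n))
                 ; (inj₂ refl) → tip∈ t₁≡1 np≡2 })
              λ { (inj₁ refl) () ; (inj₂ refl) () }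
    where
    cover : ∀ {w} → Truncated n w → ⁅ centre ⁆ w ⊎ ⁅ inj₂ (p , t₀) ∣ inj₂ (p , t₁) ⁆ w
    cover w∈ with only-leg-cover n p others w∈
    ... | inj₁ w≡c = inj₁ w≡c
    ... | inj₂ (t , refl , t<np) = inj₂ (on-long-leg np≡2 t₀≡0 t₁≡1 t t<np)

  Truncated-∖-centreBase-long : ∀ n p (t₀ t₁ : Fin (ℓ p)) → n p ≡ 2 → toℕ t₀ ≡ 0 → toℕ t₁ ≡ 1 →
                                (∀ q → q ≢ p → n q ≡ 0) →
                                Truncated n ∖ ⁅ centre ∣ inj₂ (p , t₀) ⁆ ≐ ⁅ inj₂ (p , t₁) ⁆
  Truncated-∖-centreBase-long n p t₀ t₁ np≡2 t₀≡0 t₁≡1 others =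
    ∖-≐ cover (λ { refl → tip∈ t₁≡1 np≡2 }) λ { refl → [ (λ ()) , base≢tip t₀≡0 t₁≡1 ∘ sym ] }
    where
    cover : ∀ {w} → Truncated n w → ⁅ centre ∣ inj₂ (p , t₀) ⁆ w ⊎ ⁅ inj₂ (p , t₁) ⁆ w
    cover w∈ with only-leg-cover n p others w∈
    ... | inj₁ w≡c = inj₁ (inj₁ w≡c)
    ... | inj₂ (t , refl , t<np) = map₁ inj₂ (on-long-leg np≡2 t₀≡0 t₁≡1 t t<np)

  Truncated-∖-centreBase-short : ∀ n p (t₀ : Fin (ℓ p)) → n p ≡ 1 → toℕ t₀ ≡ 0 →
                                 Truncated n ∖ ⁅ centre ∣ inj₂ (p , t₀) ⁆ ≐ Centreless (n [ p ]≔ 0)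
  Truncated-∖-centreBase-short n p t₀ np≡1 t₀≡0 =
    ≐-trans ∖-⁅∣⁆ (∖-cong (Truncated-∖-leaf n p t₀ np≡1 t₀≡0) ≐-refl)

  Centreless-connected⇒legs≤1 : ∀ n → Fits n → ConnectedOrEmpty G (Centreless n) → legs n ≤ 1
  Centreless-connected⇒legs≤1 n fits conn with legs n ≤? 1
  ... | yes legs≤1 = legs≤1
  ... | no legs≰1 =
    let p , 1≤np = nonemptyLeg n (≤-trans (s≤s z≤n) (≰⇒> legs≰1))
        q , q≢p , 1≤nq = otherLeg n p 1≤np (≰⇒> legs≰1)
        t , t≡0 = base fits p 1≤np
        s , s≡0 = base fits q 1≤nq
    in ⊥-elim (¬Reach-otherLeg (λ (_ , c∉) → c∉ refl) q≢p
                 (conn _ _ (base∈ t≡0 1≤np , λ ()) (base∈ s≡0 1≤nq , λ ())))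

  -- longLegs n + legs n is the number of vertices left: none, a single vertex, or the two ends of an edge.
  Centreless-value : ∀ n → Fits n → legs n ≤ 1 → HasGrundy G (Centreless n) (longLegs n + legs n)
  Centreless-value n fits legs≤1 with n≤1⇒n≡0∨n≡1 legs≤1
  ... | inj₁ legs≡0 =
    subst (HasGrundy G (Centreless n)) (sym (cong₂ _+_ longLegs≡0 legs≡0))
          (HasGrundy-empty (Centreless-empty n legs≡0))
    where
    longLegs≡0 : longLegs n ≡ 0
    longLegs≡0 = n≤0⇒n≡0 (subst (longLegs n ≤_) legs≡0 (longLegs≤legs n))
  ... | inj₂ legs≡1 =
    let p , 1≤np = nonemptyLeg n (≤-reflexive (sym legs≡1))
    in subst (HasGrundy G (Centreless n)) (sym (cong₂ _+_ (onlyLeg-longLegs n p 1≤np legs≡1) legs≡1))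
             (single-leg p 1≤np (onlyLeg n p 1≤np legs≡1))
    where
    single-leg : ∀ p → 1 ≤ n p → (∀ q → q ≢ p → n q ≡ 0) → HasGrundy G (Centreless n) (𝟙[≡2] (n p) + 1)
    single-leg p 1≤np others with 1≤x≤2⇒ 1≤np (≤-trans (fits p) (ℓ≤2 p))
    ... | inj₁ np≡1 =
      let t₀ , t₀≡0 = base fits p 1≤np
      in subst (λ x → HasGrundy G (Centreless n) (𝟙[≡2] x + 1)) (sym np≡1) $
         HasGrundy-resp-≐ (≐-sym (Centreless-shortLeg n p t₀ np≡1 t₀≡0 others)) HasGrundy-⁅⁆
    ... | inj₂ np≡2 =
      let t₀ , t₀≡0 = base fits p 1≤np
          t₁ , t₁≡1 = tip fits p np≡2
      in subst (λ x → HasGrundy G (Centreless n) (𝟙[≡2] x + 1)) (sym np≡2) $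
         HasGrundy-resp-≐ (≐-sym (Centreless-longLeg n p t₀ t₁ np≡2 t₀≡0 t₁≡1 others))
                          (HasGrundy-⁅∣⁆ (base≢tip t₀≡0 t₁≡1) (p-p p t₀ t₁ (trans (cong suc t₀≡0) (sym t₁≡1))))

  value-dropShort≢ : ∀ n p → n p ≡ 1 → value (n [ p ]≔ 0) ≢ value n
  value-dropShort≢ n p np≡1 eq =
    let legs≡ , longLegs≡ = dropShort-counts n p np≡1
    in table-i≢table-1+i _ _ (longLegs≤legs _) (trans eq (cong₂ table legs≡ longLegs≡))

  value-trimLong≢ : ∀ n p → n p ≡ 2 → value (n [ p ]≔ 1) ≢ value n
  value-trimLong≢ n p np≡2 eq =
    let legs≡ , longLegs≡ = trimLong-counts n p np≡2
    in table-j≢table-1+j _ _ (subst₂ _≤_ longLegs≡ legs≡ (longLegs≤legs n))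
                            (trans eq (cong₂ table legs≡ longLegs≡))

  value-dropLong≢ : ∀ n p → n p ≡ 2 → value (n [ p ]≔ 0) ≢ value n
  value-dropLong≢ n p np≡2 eq =
    let legs≡ , longLegs≡ = dropLong-counts n p np≡2
    in table-ij≢table-1+i-1+j _ _ (longLegs≤legs _) (trans eq (cong₂ table legs≡ longLegs≡))

  module Moves (n : Lengths) (fits : Fits n)
               (ih : ∀ {n′} → ∑ n′ < ∑ n → Fits n′ → HasGrundy G (Truncated n′) (value n′)) where

    np≤2 : ∀ p → n p ≤ 2
    np≤2 p = ≤-trans (fits p) (ℓ≤2 p)

    Option : VSet G → Set₁
    Option X = ∃ λ h → HasGrundy G (Truncated n ∖ X) h × h ≢ value n

    Option-swap : ∀ {a b} → Option ⁅ a ∣ b ⁆ → Option ⁅ b ∣ a ⁆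
    Option-swap (h , γ , h≢value) = h , HasGrundy-resp-≐ (∖-cong ≐-refl ⁅∣⁆-comm) γ , h≢value

    connected-swap : ∀ {a b} → ConnectedOrEmpty G (Truncated n ∖ ⁅ a ∣ b ⁆) →
                     ConnectedOrEmpty G (Truncated n ∖ ⁅ b ∣ a ⁆)
    connected-swap = ConnectedOrEmpty-resp-≐ (∖-cong ≐-refl ⁅∣⁆-comm)

    shortened : ∀ p b → b < n p → HasGrundy G (Truncated (n [ p ]≔ b)) (value (n [ p ]≔ b))
    shortened p b b<np = ih (∑-[]≔-< n p b b<np) ([]≔-fits p b (<⇒≤ b<np) fits)

    leaf-removed : ∀ p (t : Fin (ℓ p)) → n p ≡ 1 → toℕ t ≡ 0 →
                   HasGrundy G (Truncated n ∖ ⁅ inj₂ (p , t) ⁆) (value (n [ p ]≔ 0))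
    leaf-removed p t np≡1 t≡0 =
      HasGrundy-resp-≐ (≐-sym (Truncated-∖-leaf n p t np≡1 t≡0))
                       (shortened p 0 (subst (0 <_) (sym np≡1) (s≤s z≤n)))

    tip-removed : ∀ p (t : Fin (ℓ p)) → n p ≡ 2 → toℕ t ≡ 1 →
                  HasGrundy G (Truncated n ∖ ⁅ inj₂ (p , t) ⁆) (value (n [ p ]≔ 1))
    tip-removed p t np≡2 t≡1 =
      HasGrundy-resp-≐ (≐-sym (Truncated-∖-tip n p t np≡2 t≡1))
                       (shortened p 1 (subst (1 <_) (sym np≡2) ≤-refl))

    leg-removed : ∀ p (t₀ t₁ : Fin (ℓ p)) → n p ≡ 2 → toℕ t₀ ≡ 0 → toℕ t₁ ≡ 1 →
                  HasGrundy G (Truncated n ∖ ⁅ inj₂ (p , t₀) ∣ inj₂ (p , t₁) ⁆) (value (n [ p ]≔ 0))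
    leg-removed p t₀ t₁ np≡2 t₀≡0 t₁≡1 =
      HasGrundy-resp-≐ (≐-sym (Truncated-∖-leg n p t₀ t₁ np≡2 t₀≡0 t₁≡1))
                       (shortened p 0 (subst (0 <_) (sym np≡2) (s≤s z≤n)))

    leg-vertex-option : ∀ p (t : Fin (ℓ p)) → toℕ t < n p →
                        ConnectedOrEmpty G (Truncated n ∖ ⁅ inj₂ (p , t) ⁆) →
                        Option ⁅ inj₂ (p , t) ⁆
    leg-vertex-option p t t<np conn with 1≤x≤2⇒ (≤-trans (s≤s z≤n) t<np) (np≤2 p)
    ... | inj₁ np≡1 =
      let t≡0 = n<1⇒n≡0 (subst (toℕ t <_) np≡1 t<np)
      in value (n [ p ]≔ 0) , leaf-removed p t np≡1 t≡0 , value-dropShort≢ n p np≡1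
    ... | inj₂ np≡2 with x<2⇒ (subst (toℕ t <_) np≡2 t<np)
    ...   | inj₂ t≡1 = value (n [ p ]≔ 1) , tip-removed p t np≡2 t≡1 , value-trimLong≢ n p np≡2
    ...   | inj₁ t≡0 =
      let t₁ , t₁≡1 = tip fits p np≡2
      in ⊥-elim (¬Reach-centre t t≡0 (λ (_ , t∉) → t∉ refl) (refl , ≤-reflexive (sym t₁≡1))
                  (conn _ _ (tip∈ t₁≡1 np≡2 , base≢tip t≡0 t₁≡1 ∘ sym) (tt , λ ())))

    long-leg-option : ∀ p (a b : Fin (ℓ p)) → suc (toℕ a) ≡ toℕ b → toℕ b < n p →
                      Option ⁅ inj₂ (p , a) ∣ inj₂ (p , b) ⁆
    long-leg-option p a b 1+a≡b b<np with x<2⇒ (<-≤-trans b<np (np≤2 p))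
    ... | inj₁ b≡0 = contradiction (trans 1+a≡b b≡0) λ ()
    ... | inj₂ b≡1 =
      let np≡2 = ≤-antisym (np≤2 p) (subst (_< n p) b≡1 b<np)
      in value (n [ p ]≔ 0) ,
         leg-removed p a b np≡2 (suc-injective (trans 1+a≡b b≡1)) b≡1 ,
         value-dropLong≢ n p np≡2

    centre-option : ConnectedOrEmpty G (Centreless n) → Option ⁅ centre ⁆
    centre-option conn =
      let legs≤1 = Centreless-connected⇒legs≤1 n fits conn
      in longLegs n + legs n , Centreless-value n fits legs≤1 , table-i≤1≢j+i legs≤1 (longLegs≤legs n)

    centreBase-option-short : ∀ p (t₀ : Fin (ℓ p)) → toℕ t₀ ≡ 0 → n p ≡ 1 →
                              ConnectedOrEmpty G (Truncated n ∖ ⁅ centre ∣ inj₂ (p , t₀) ⁆) →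
                              Option ⁅ centre ∣ inj₂ (p , t₀) ⁆
    centreBase-option-short p t₀ t₀≡0 np≡1 conn =
      let n′ = n [ p ]≔ 0
          fits′ = []≔-fits p 0 z≤n fits
          residual≐ = Truncated-∖-centreBase-short n p t₀ np≡1 t₀≡0
          legs′≤1 = Centreless-connected⇒legs≤1 n′ fits′ (ConnectedOrEmpty-resp-≐ residual≐ conn)
          legs≡ , longLegs≡ = dropShort-counts n p np≡1
      in longLegs n′ + legs n′ ,
         HasGrundy-resp-≐ (≐-sym residual≐) (Centreless-value n′ fits′ legs′≤1) ,
         λ eq → table-1+i≢j+i legs′≤1 (longLegs≤legs n′) (trans eq (cong₂ table legs≡ longLegs≡))

    centreBase-option-long : ∀ p (t₀ : Fin (ℓ p)) → toℕ t₀ ≡ 0 → n p ≡ 2 →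
                             ConnectedOrEmpty G (Truncated n ∖ ⁅ centre ∣ inj₂ (p , t₀) ⁆) →
                             Option ⁅ centre ∣ inj₂ (p , t₀) ⁆
    centreBase-option-long p t₀ t₀≡0 np≡2 conn = by-legs (legs n ≤? 1)
      where
      1≤np : 1 ≤ n p
      1≤np = subst (1 ≤_) (sym np≡2) (s≤s z≤n)
      by-legs : Dec (legs n ≤ 1) → Option ⁅ centre ∣ inj₂ (p , t₀) ⁆
      by-legs (yes legs≤1) =
        let legs≡1 = ≤-antisym legs≤1 (subst (1 ≤_) (sym (legs-[]≔0 n p 1≤np)) (s≤s z≤n))
            t₁ , t₁≡1 = tip fits p np≡2
            residual≐ = Truncated-∖-centreBase-long n p t₀ t₁ np≡2 t₀≡0 t₁≡1 (onlyLeg n p 1≤np legs≡1)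
            value≡0 = cong₂ table legs≡1 (trans (onlyLeg-longLegs n p 1≤np legs≡1) (cong 𝟙[≡2] np≡2))
        in 1 , HasGrundy-resp-≐ (≐-sym residual≐) HasGrundy-⁅⁆ , λ eq → contradiction (trans eq value≡0) λ ()
      by-legs (no legs≰1) =
        let q , q≢p , 1≤nq = otherLeg n p 1≤np (≰⇒> legs≰1)
            t₁ , t₁≡1 = tip fits p np≡2
            s₀ , s₀≡0 = base fits q 1≤nq
        in ⊥-elim (¬Reach-otherLeg (λ (_ , c∉) → c∉ (inj₁ refl)) q≢p
                     (conn _ _ (tip∈ t₁≡1 np≡2 , [ (λ ()) , base≢tip t₀≡0 t₁≡1 ∘ sym ])
                               (base∈ s₀≡0 1≤nq , [ (λ ()) , otherLeg≢ q≢p ])))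

    centreBase-option : ∀ p (t₀ : Fin (ℓ p)) → toℕ t₀ ≡ 0 → toℕ t₀ < n p →
                        ConnectedOrEmpty G (Truncated n ∖ ⁅ centre ∣ inj₂ (p , t₀) ⁆) →
                        Option ⁅ centre ∣ inj₂ (p , t₀) ⁆
    centreBase-option p t₀ t₀≡0 t₀<np =
      [ centreBase-option-short p t₀ t₀≡0 , centreBase-option-long p t₀ t₀≡0 ]
      (1≤x≤2⇒ (subst (_< n p) t₀≡0 t₀<np) (np≤2 p))

    option : (m : Move G (Truncated n)) → Option (removed G m)
    option (one (inj₁ tt) c∈ legal) = centre-option (legal⇒connected _ c∈ legal)
    option (one (inj₂ (p , t)) t<np legal) = leg-vertex-option p t t<np (legal⇒connected _ t<np legal)
    option (two _ _ c∈ t<np (c-p p t t≡0) legal) = centreBase-option p t t≡0 t<np (legal⇒connected _ c∈ legal)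
    option (two _ _ t<np _ (p-c p t t≡0) legal) =
      Option-swap (centreBase-option p t t≡0 t<np (connected-swap (legal⇒connected _ t<np legal)))
    option (two _ _ _ b<np (p-p p a b 1+a≡b) _) = long-leg-option p a b 1+a≡b b<np
    option (two _ _ b<np _ (p-p' p a b 1+a≡b) _) = Option-swap (long-leg-option p a b 1+a≡b b<np)

    retable : ∀ {A n′ i j} → legs n′ ≡ i → longLegs n′ ≡ j →
              HasGrundy G A (value n′) → HasGrundy G A (table i j)
    retable legs≡ longLegs≡ = subst (HasGrundy G _) (cong₂ table legs≡ longLegs≡)

    Reached : ℕ → Set₁
    Reached h = ∃ λ (m : Move G (Truncated n)) → HasGrundy G (after G (Truncated n) m) h

    legal-if-truncated : ∀ {u X n′} → Truncated n u → Truncated n ∖ X ≐ Truncated n′ →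
                         ConnectedOrEmpty G (Component G (Truncated n) u ∖ X)
    legal-if-truncated u∈ residual≐ =
      connected⇒legal _ u∈ (ConnectedOrEmpty-resp-≐ (≐-sym residual≐) (Truncated-connected _))

    legal-if-empty : ∀ {u X} → Truncated n u → Empty (Truncated n ∖ X) →
                     ConnectedOrEmpty G (Component G (Truncated n) u ∖ X)
    legal-if-empty u∈ empty = connected⇒legal _ u∈ (ConnectedOrEmpty-empty empty)

    reach : ∀ {i j h} → TableOption i j h → legs n ≡ i → longLegs n ≡ j → Reached h
    reach (dropShort j≤i refl) legs≡ longLegs≡ =
      let p , np≡1 = shortLeg n fits (subst₂ _<_ (sym longLegs≡) (sym legs≡) (s≤s j≤i))
          1≤np = ≤-reflexive (sym np≡1)
          t , t≡0 = base fits p 1≤np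
          legs′≡ , longLegs′≡ = dropShort-counts n p np≡1
      in one _ (base∈ t≡0 1≤np) (legal-if-truncated (base∈ t≡0 1≤np) (Truncated-∖-leaf n p t np≡1 t≡0)) ,
         retable (suc-injective (trans (sym legs′≡) legs≡)) (trans (sym longLegs′≡) longLegs≡)
                 (leaf-removed p t np≡1 t≡0)
    reach (trimLong refl) legs≡ longLegs≡ =
      let p , np≡2 = longLeg n (subst (1 ≤_) (sym longLegs≡) (s≤s z≤n))
          t , t≡1 = tip fits p np≡2
          legs′≡ , longLegs′≡ = trimLong-counts n p np≡2
      in one _ (tip∈ t≡1 np≡2) (legal-if-truncated (tip∈ t≡1 np≡2) (Truncated-∖-tip n p t np≡2 t≡1)) ,
         retable (trans (sym legs′≡) legs≡) (suc-injective (trans (sym longLegs′≡) longLegs≡))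
                 (tip-removed p t np≡2 t≡1)
    reach (dropLong refl) legs≡ longLegs≡ =
      let p , np≡2 = longLeg n (subst (1 ≤_) (sym longLegs≡) (s≤s z≤n))
          1≤np = subst (1 ≤_) (sym np≡2) (s≤s z≤n)
          t₀ , t₀≡0 = base fits p 1≤np
          t₁ , t₁≡1 = tip fits p np≡2
          legs′≡ , longLegs′≡ = dropLong-counts n p np≡2
      in two _ _ (base∈ t₀≡0 1≤np) (tip∈ t₁≡1 np≡2) (p-p p t₀ t₁ (trans (cong suc t₀≡0) (sym t₁≡1)))
             (legal-if-truncated (base∈ t₀≡0 1≤np) (Truncated-∖-leg n p t₀ t₁ np≡2 t₀≡0 t₁≡1)) ,
         retable (suc-injective (trans (sym legs′≡) legs≡)) (suc-injective (trans (sym longLegs′≡) longLegs≡))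
                 (leg-removed p t₀ t₁ np≡2 t₀≡0 t₁≡1)
    reach clearSingle legs≡0 _ =
      one centre tt (legal-if-empty tt (Centreless-empty n legs≡0)) ,
      HasGrundy-empty (Centreless-empty n legs≡0)
    reach clearEdge legs≡1 longLegs≡0 =
      let p , np≡1 = shortLeg n fits (subst₂ _<_ (sym longLegs≡0) (sym legs≡1) (s≤s z≤n))
          1≤np = ≤-reflexive (sym np≡1)
          t , t≡0 = base fits p 1≤np
          residual≐ = Truncated-∖-centreBase-short n p t np≡1 t≡0
          empty : Empty (Truncated n ∖ ⁅ centre ∣ inj₂ (p , t) ⁆)
          empty w w∈ = Centreless-empty (n [ p ]≔ 0) (legs≡1⇒others≡0 n p 1≤np legs≡1) w (proj₁ residual≐ w∈)
      in two _ _ tt (base∈ t≡0 1≤np) (c-p p t t≡0) (legal-if-empty tt empty) , HasGrundy-empty empty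

    mex : ∀ h → h < value n → Reached h
    mex h h<value = subst Reached (toℕ-fromℕ< h<value)
                      (reach (table-mex (legs n) (longLegs n) (longLegs≤legs n) (fromℕ< h<value)) refl refl)

  Truncated-value : ∀ n → Fits n → HasGrundy G (Truncated n) (value n)
  Truncated-value =
    All.wfRec (On.wellFounded ∑ <-wellFounded) _ (λ n → Fits n → HasGrundy G (Truncated n) (value n))
      λ n ih fits → let open Moves n fits ih in HasGrundy-intro option mex

∑-𝟙[≡2]≡countTwos : ∀ k (ℓ : Fin k → ℕ) → ∑ (𝟙[≡2] ∘ ℓ) ≡ countTwos k ℓ
∑-𝟙[≡2]≡countTwos zero ℓ = refl
∑-𝟙[≡2]≡countTwos (suc k) ℓ = cong (𝟙[≡2] (ℓ fzero) +_) (∑-𝟙[≡2]≡countTwos k (ℓ ∘ fsuc))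

star-value : ∀ k (ℓ : Fin k → ℕ) → (∀ p → ℓ p ≡ 1 ⊎ ℓ p ≡ 2) → 𝒢 (star k ℓ) ≡ table k (countTwos k ℓ)
star-value k ℓ ℓ∈12 =
  subst (HasGrundy (star k ℓ) _) (cong₂ table legs≡k (∑-𝟙[≡2]≡countTwos k ℓ))
        (HasGrundy-resp-≐ Truncated-ℓ≐all (Truncated-value ℓ (λ _ → ≤-refl)))
  where
  ℓ≤2 : ∀ p → ℓ p ≤ 2
  ℓ≤2 p = [ (λ ℓp≡1 → subst (_≤ 2) (sym ℓp≡1) (s≤s z≤n)) , ≤-reflexive ] (ℓ∈12 p)
  open Star ℓ≤2
  open Positions (star k ℓ)
  Truncated-ℓ≐all : Truncated ℓ ≐ (λ _ → ⊤)
  Truncated-ℓ≐all = (λ _ → tt) , λ { {inj₁ _} _ → tt ; {inj₂ (p , t)} _ → toℕ<n t }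
  legs≡k : legs ℓ ≡ k
  legs≡k = trans (∑-cong (λ p → [ cong 𝟙[>0] , cong 𝟙[>0] ] (ℓ∈12 p))) (trans (∑-const k 1) (*-identityʳ k))

theorem3 : (𝒢 emptyGraph ≡ 0)
           × ((k : ℕ) (ℓ : Fin k → ℕ) → (∀ p → ℓ p ≡ 1 ⊎ ℓ p ≡ 2) →
              𝒢 (star k ℓ) ≡ table k (countTwos k ℓ))
theorem3 = Positions.HasGrundy-empty emptyGraph (λ ()) , star-value
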